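{- Let $\rho$ be a positive odd integer and $m\ge1$, and set $n=\rho\cdot2^{m+1}$, $\ell=\rho\cdot2^m$. Then $\Delta_{n,\ell}$ is a pure simplicial complex.
   Context: For integers $0<\ell<n$, $\Delta_{n,\ell}$ is the simplicial complex of all subsets $S\subseteq\mathbb Z/n\mathbb Z$ such that there are no nonnegative integers $c_s$ ($s\in S$) with $\sum_{s\in S}c_s=\ell$ and $\sum_{s\in S}c_s s=0$ in $\mathbb Z/n\mathbb Z$. A simplicial complex is pure if all its facets (inclusion-maximal faces) have the same dimension (dimension of a face $S$ is $|S|-1$). -}

module Defs where

open import Data.Nat using (ℕ; _*_; _+_; _^_)
open import Data.Nat.Divisibility using (_∣_)
open import Data.Fin using (Fin; toℕ)
open import Data.Fin.Subset using (Subset; _∈_; _∉_; _⊆_; ∣_∣)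
open import Data.Vec using (tabulate; sum)
open import Data.Product using (∃; _×_)
open import Relation.Nullary using (¬_)
open import Relation.Binary.PropositionalEquality using (_≡_)

-- Z/nZ is modelled by Fin n (element i ↔ residue class of toℕ i).
-- A subset S ⊆ Z/nZ is a Subset n.

ZeroSumOfLength : (n ℓ : ℕ) → Subset n → (Fin n → ℕ) → Set
ZeroSumOfLength n ℓ S c =
  (∀ i → i ∉ S → c i ≡ 0)
  × sum (tabulate c) ≡ ℓ
  × n ∣ sum (tabulate (λ i → c i * toℕ i))

IsFace : (n ℓ : ℕ) → Subset n → Set
IsFace n ℓ S = ¬ ∃ (λ c → ZeroSumOfLength n ℓ S c)

IsFacet : (n ℓ : ℕ) → Subset n → Set
IsFacet n ℓ S = IsFace n ℓ S × (∀ T → S ⊆ T → IsFace n ℓ T → T ⊆ S)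

-- Δ_{n,ℓ} is pure: all facets have the same cardinality (hence dimension)
IsPure : (n ℓ : ℕ) → Set
IsPure n ℓ = ∀ S T → IsFacet n ℓ S → IsFacet n ℓ T → ∣ S ∣ ≡ ∣ T ∣

-- Put M = 2^(m+1), L = ρ 2^m and N = 2L. A face of Δ_{N,L} contains no even x, since L copies
-- of x sum to L x ≡ 0 (mod N), and no x < y with y − x ≢ 0 (mod M), since then the length L can
-- be split between x and y to give a zero sum. Conversely every odd residue class r mod M is a
-- face: a weighted sum of length L over it is ≡ r L (mod M), and M ∤ r L because r ρ is odd.
-- So the facets are exactly the odd residue classes mod M, each of which has ρ elements.
module Submission where

open import Data.Bool using (Bool; true; false; if_then_else_)
open import Data.Bool.Properties using (T-≡)
open import Data.Empty using (⊥-elim)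
open import Data.Fin using (Fin; zero; suc; toℕ)
open import Data.Fin.Properties using () renaming (_≟_ to _≟ᶠ_)
open import Data.Fin.Subset using (Subset; _∈_; _∉_; _⊆_; ∣_∣)
open import Data.Fin.Subset.Properties using (_∈?_; nonempty?; ⊆-antisym)
open import Data.Nat using (ℕ; zero; suc; _+_; _*_; _∸_; _^_; _≤_; _<_; _≥_; _≡ᵇ_; z≤n; s≤s; NonZero)
open import Data.Nat.DivMod
  using (_%_; _/_; m%n<n; m≡m%n+[m/n]*n; [m+n]%n≡m%n; [m+kn]%n≡m%n; m<n⇒m%n≡m; %-distribˡ-+; %-distribˡ-*)
open import Data.Nat.Divisibility
  using (_∣_; _∤_; divides; _∣?_; ∣-trans; m∣m*n; n∣m*n; *-monoˡ-∣; *-cancelˡ-∣; ∣m+n∣m⇒∣n;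
         m%n≡0⇒n∣m; n∣m⇒m%n≡0; ∣n∣m%n⇒∣m; >⇒∤)
open import Data.Nat.Properties
open import Data.Nat.Solver using (module +-*-Solver)
open import Data.Product using (∃; ∃₂; _×_; _,_)
open import Data.Sum using (inj₁; inj₂)
open import Data.Vec using (tabulate; sum)
open import Data.Vec.Properties using (lookup∘tabulate; []=⇒lookup; lookup⇒[]=)
open import Function using (_∘_)
open import Function.Bundles using (Equivalence)
open import Relation.Binary.PropositionalEquality
open import Relation.Nullary using (¬_; yes; no)
open import Relation.Nullary.Decidable using (decidable-stable)

open import Defs
open +-*-Solver using (solve; _:=_; _:+_; _:*_; con)
open import Algebra.Properties.Semiring.Sum +-*-semiring
  using (sum-cong-≗; sum-replicate-zero; ∑-distrib-+; *-distribˡ-sum)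
  renaming (sum to ∑)

sum-tabulate : ∀ {n} (f : Fin n → ℕ) → sum (tabulate f) ≡ ∑ f
sum-tabulate {zero}  f = refl
sum-tabulate {suc n} f = cong (f zero +_) (sum-tabulate (f ∘ suc))

pointMass : ∀ {n} → Fin n → ℕ → Fin n → ℕ
pointMass zero    v zero    = v
pointMass zero    v (suc i) = 0
pointMass (suc a) v zero    = 0
pointMass (suc a) v (suc i) = pointMass a v i

pointMass-≢ : ∀ {n} {a i : Fin n} v → i ≢ a → pointMass a v i ≡ 0
pointMass-≢ {a = zero}  {zero}  v i≢a = ⊥-elim (i≢a refl)
pointMass-≢ {a = zero}  {suc i} v i≢a = refl
pointMass-≢ {a = suc a} {zero}  v i≢a = refl
pointMass-≢ {a = suc a} {suc i} v i≢a = pointMass-≢ v (i≢a ∘ cong suc)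

∑-pointMass-* : ∀ {n} (a : Fin n) v (w : Fin n → ℕ) → ∑ (λ i → pointMass a v i * w i) ≡ v * w a
∑-pointMass-* {suc n} zero    v w = trans (cong (v * w zero +_) (sum-replicate-zero n)) (+-identityʳ _)
∑-pointMass-* {suc n} (suc a) v w = ∑-pointMass-* a v (w ∘ suc)

∑-pointMass : ∀ {n} (a : Fin n) v → ∑ (pointMass a v) ≡ v
∑-pointMass {suc n} zero    v = trans (cong (v +_) (sum-replicate-zero n)) (+-identityʳ v)
∑-pointMass {suc n} (suc a) v = ∑-pointMass a v

¬IsFace-pair : ∀ {n ℓ} {S : Subset n} {a b : Fin n} (u v : ℕ) → a ∈ S → b ∈ S →
               u + v ≡ ℓ → n ∣ u * toℕ a + v * toℕ b → ¬ IsFace n ℓ S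
¬IsFace-pair {n} {ℓ} {S} {a} {b} u v a∈S b∈S u+v≡ℓ n∣ face = face (c , support , total , weighted)
  where
  c : Fin n → ℕ
  c i = pointMass a u i + pointMass b v i
  support : ∀ i → i ∉ S → c i ≡ 0
  support i i∉S with i ≟ᶠ a | i ≟ᶠ b
  ... | yes refl | _        = ⊥-elim (i∉S a∈S)
  ... | no _     | yes refl = ⊥-elim (i∉S b∈S)
  ... | no i≢a   | no i≢b   = cong₂ _+_ (pointMass-≢ u i≢a) (pointMass-≢ v i≢b)
  total : sum (tabulate c) ≡ ℓ
  total = begin
    sum (tabulate c)                       ≡⟨ sum-tabulate c ⟩
    ∑ c                                    ≡⟨ ∑-distrib-+ (pointMass a u) (pointMass b v) ⟩
    ∑ (pointMass a u) + ∑ (pointMass b v)  ≡⟨ cong₂ _+_ (∑-pointMass a u) (∑-pointMass b v) ⟩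
    u + v                                  ≡⟨ u+v≡ℓ ⟩
    ℓ                                      ∎
    where open ≡-Reasoning
  weighted : n ∣ sum (tabulate (λ i → c i * toℕ i))
  weighted = subst (n ∣_) (sym (begin
    sum (tabulate (λ i → c i * toℕ i))  ≡⟨ sum-tabulate (λ i → c i * toℕ i) ⟩
    ∑ (λ i → c i * toℕ i)               ≡⟨ sum-cong-≗ (λ i → *-distribʳ-+ (toℕ i) (pointMass a u i) (pointMass b v i)) ⟩
    ∑ (λ i → pointMass a u i * toℕ i + pointMass b v i * toℕ i)
      ≡⟨ ∑-distrib-+ (λ i → pointMass a u i * toℕ i) (λ i → pointMass b v i * toℕ i) ⟩
    ∑ (λ i → pointMass a u i * toℕ i) + ∑ (λ i → pointMass b v i * toℕ i)
      ≡⟨ cong₂ _+_ (∑-pointMass-* a u toℕ) (∑-pointMass-* b v toℕ) ⟩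
    u * toℕ a + v * toℕ b               ∎)) n∣
    where open ≡-Reasoning

residueClass : (n M r : ℕ) .{{_ : NonZero M}} → Subset n
residueClass n M r = tabulate (λ i → toℕ i % M ≡ᵇ r)

module _ {n M r : ℕ} .{{_ : NonZero M}} {i : Fin n} where

  ∈residueClass⁺ : toℕ i % M ≡ r → i ∈ residueClass n M r
  ∈residueClass⁺ i≡r = lookup⇒[]= i _ (trans (lookup∘tabulate _ i) (Equivalence.to T-≡ (≡⇒≡ᵇ _ _ i≡r)))

  ∈residueClass⁻ : i ∈ residueClass n M r → toℕ i % M ≡ r
  ∈residueClass⁻ i∈ = ≡ᵇ⇒≡ _ _ (Equivalence.from T-≡ (trans (sym (lookup∘tabulate _ i)) ([]=⇒lookup i∈)))

count< : (ℕ → Bool) → ℕ → ℕ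
count< p zero    = 0
count< p (suc k) = if p 0 then suc (count< (p ∘ suc) k) else count< (p ∘ suc) k

∣tabulate∣≡count< : ∀ n (p : ℕ → Bool) → ∣ tabulate {n = n} (p ∘ toℕ) ∣ ≡ count< p n
∣tabulate∣≡count< zero    p = refl
∣tabulate∣≡count< (suc n) p with p 0
... | true  = cong suc (∣tabulate∣≡count< n (p ∘ suc))
... | false = ∣tabulate∣≡count< n (p ∘ suc)

count<-cong : ∀ k {p q : ℕ → Bool} → (∀ x → x < k → p x ≡ q x) → count< p k ≡ count< q k
count<-cong zero    p≗q = refl
count<-cong (suc k) p≗q =
  cong₂ (λ b c → if b then suc c else c) (p≗q 0 (s≤s z≤n)) (count<-cong k (λ x x<k → p≗q (suc x) (s≤s x<k)))

count<-+ : ∀ a b (p : ℕ → Bool) → count< p (a + b) ≡ count< p a + count< (λ x → p (a + x)) b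
count<-+ zero    b p = refl
count<-+ (suc a) b p with p 0
... | true  = cong suc (count<-+ a b (p ∘ suc))
... | false = count<-+ a b (p ∘ suc)

count<-periodic : ∀ k M (p : ℕ → Bool) → (∀ x → p (M + x) ≡ p x) → count< p (k * M) ≡ k * count< p M
count<-periodic zero    M p periodic = refl
count<-periodic (suc k) M p periodic = begin
  count< p (M + k * M)                             ≡⟨ count<-+ M (k * M) p ⟩
  count< p M + count< (λ x → p (M + x)) (k * M)    ≡⟨ cong (count< p M +_) (count<-cong (k * M) (λ x _ → periodic x)) ⟩
  count< p M + count< p (k * M)                    ≡⟨ cong (count< p M +_) (count<-periodic k M p periodic) ⟩
  count< p M + k * count< p M                      ∎
  where open ≡-Reasoning

count<-≡ᵇ : ∀ {r k} → r < k → count< (_≡ᵇ r) k ≡ 1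
count<-≡ᵇ {zero}  {suc k} _         = cong suc (none k)
  where
  none : ∀ k → count< (λ x → suc x ≡ᵇ 0) k ≡ 0
  none zero    = refl
  none (suc k) = none k
count<-≡ᵇ {suc r} {suc k} (s≤s r<k) = count<-≡ᵇ r<k

∣residueClass∣ : ∀ k {M r} .{{_ : NonZero M}} → r < M → ∣ residueClass (k * M) M r ∣ ≡ k
∣residueClass∣ k {M} {r} r<M = begin
  ∣ residueClass (k * M) M r ∣  ≡⟨ ∣tabulate∣≡count< (k * M) p ⟩
  count< p (k * M)              ≡⟨ count<-periodic k M p p-periodic ⟩
  k * count< p M                ≡⟨ cong (k *_) (count<-cong M (λ x x<M → cong (_≡ᵇ r) (m<n⇒m%n≡m x<M))) ⟩
  k * count< (_≡ᵇ r) M          ≡⟨ cong (k *_) (count<-≡ᵇ r<M) ⟩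
  k * 1                         ≡⟨ *-identityʳ k ⟩
  k                             ∎
  where
  open ≡-Reasoning
  p : ℕ → Bool
  p x = x % M ≡ᵇ r
  p-periodic : ∀ x → p (M + x) ≡ p x
  p-periodic x = cong (_≡ᵇ r) (trans (cong (_% M) (+-comm M x)) ([m+n]%n≡m%n x M))

∑-*-toℕ-residueClass : ∀ {n M} .{{_ : NonZero M}} r (c : Fin n → ℕ) →
                       (∀ i → i ∉ residueClass n M r → c i ≡ 0) →
                       ∑ (λ i → c i * toℕ i) ≡ M * ∑ (λ i → c i * (toℕ i / M)) + r * ∑ c
∑-*-toℕ-residueClass {n} {M} r c support = begin
  ∑ (λ i → c i * toℕ i)                  ≡⟨ sum-cong-≗ split ⟩
  ∑ (λ i → M * q i + r * c i)            ≡⟨ ∑-distrib-+ (λ i → M * q i) (λ i → r * c i) ⟩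
  ∑ (λ i → M * q i) + ∑ (λ i → r * c i)  ≡⟨ sym (cong₂ _+_ (*-distribˡ-sum M q) (*-distribˡ-sum r c)) ⟩
  M * ∑ q + r * ∑ c                      ∎
  where
  open ≡-Reasoning
  q : Fin n → ℕ
  q i = c i * (toℕ i / M)
  split : ∀ i → c i * toℕ i ≡ M * q i + r * c i
  split i with i ∈? residueClass n M r
  ... | no i∉ rewrite support i i∉ = sym (cong₂ _+_ (*-zeroʳ M) (*-zeroʳ r))
  ... | yes i∈ = begin
    c i * toℕ i                        ≡⟨ cong (c i *_) (m≡m%n+[m/n]*n (toℕ i) M) ⟩
    c i * (toℕ i % M + toℕ i / M * M)  ≡⟨ cong (λ x → c i * (x + toℕ i / M * M)) (∈residueClass⁻ i∈) ⟩
    c i * (r + toℕ i / M * M)          ≡⟨ solve 4 (λ c r q m → c :* (r :+ q :* m) := m :* (c :* q) :+ r :* c) refl (c i) r (toℕ i / M) M ⟩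
    M * q i + r * c i                  ∎

odd⇒%2≡1 : ∀ {x} → 2 ∤ x → x % 2 ≡ 1
odd⇒%2≡1 {x} x-odd with x % 2 | m%n<n x 2 | m%n≡0⇒n∣m x 2
... | 0           | _            | even = ⊥-elim (x-odd (even refl))
... | 1           | _            | _    = refl
... | suc (suc _) | s≤s (s≤s ()) | _

odd+odd⇒even : ∀ {x y} → 2 ∤ x → 2 ∤ y → 2 ∣ x + y
odd+odd⇒even {x} {y} x-odd y-odd = m%n≡0⇒n∣m (x + y) 2 (begin
  (x + y) % 2          ≡⟨ %-distribˡ-+ x y 2 ⟩
  (x % 2 + y % 2) % 2  ≡⟨ cong₂ (λ a b → (a + b) % 2) (odd⇒%2≡1 x-odd) (odd⇒%2≡1 y-odd) ⟩
  0                    ∎)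
  where open ≡-Reasoning

odd*odd⇒odd : ∀ {x y} → 2 ∤ x → 2 ∤ y → 2 ∤ x * y
odd*odd⇒odd {x} {y} x-odd y-odd 2∣xy = 0≢1+n (begin
  0                      ≡⟨ sym (n∣m⇒m%n≡0 (x * y) 2 2∣xy) ⟩
  (x * y) % 2            ≡⟨ %-distribˡ-* x y 2 ⟩
  (x % 2 * (y % 2)) % 2  ≡⟨ cong₂ (λ a b → (a * b) % 2) (odd⇒%2≡1 x-odd) (odd⇒%2≡1 y-odd) ⟩
  1                      ∎)
  where open ≡-Reasoning

2^[1+k]∤⇒2^j*odd : ∀ k D → 2 ^ suc k ∤ D → ∃₂ λ j e → j ≤ k × 2 ∤ e × D ≡ 2 ^ j * e
2^[1+k]∤⇒2^j*odd k D 2^[1+k]∤D with 2 ∣? D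
... | no 2∤D = 0 , D , z≤n , 2∤D , sym (+-identityʳ D)
2^[1+k]∤⇒2^j*odd zero    D 2∤D      | yes 2∣D = ⊥-elim (2∤D 2∣D)
2^[1+k]∤⇒2^j*odd (suc k) D 2^[2+k]∤D | yes (divides q refl) with 2^[1+k]∤⇒2^j*odd k q 2^[1+k]∤q
  where
  2^[1+k]∤q : 2 ^ suc k ∤ q
  2^[1+k]∤q 2^[1+k]∣q = 2^[2+k]∤D (subst (_∣ q * 2) (*-comm (2 ^ suc k) 2) (*-monoˡ-∣ 2 2^[1+k]∣q))
... | j , e , j≤k , e-odd , q≡ = suc j , e , s≤s j≤k , e-odd , (begin
  q * 2            ≡⟨ *-comm q 2 ⟩
  2 * q            ≡⟨ cong (2 *_) q≡ ⟩
  2 * (2 ^ j * e)  ≡⟨ sym (*-assoc 2 (2 ^ j) e) ⟩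
  2 ^ suc j * e    ∎)
  where open ≡-Reasoning

%≢⇒∤∸ : ∀ {x y M} .{{_ : NonZero M}} → x ≤ y → x % M ≢ y % M → M ∤ y ∸ x
%≢⇒∤∸ {x} {y} {M} x≤y differ (divides k y∸x≡) = differ (begin
  x % M              ≡⟨ sym ([m+kn]%n≡m%n x k M) ⟩
  (x + k * M) % M    ≡⟨ cong (λ t → (x + t) % M) (sym y∸x≡) ⟩
  (x + (y ∸ x)) % M  ≡⟨ cong (_% M) (m+[n∸m]≡n x≤y) ⟩
  y % M              ∎)
  where open ≡-Reasoning

module _ (ρ m : ℕ) (ρ-odd : 2 ∤ ρ) where

  M L N : ℕ
  M = 2 ^ suc m
  L = ρ * 2 ^ m
  N = ρ * 2 ^ suc m

  instance
    2^m-nonZero : NonZero (2 ^ m)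
    2^m-nonZero = m^n≢0 2 m
    M-nonZero : NonZero M
    M-nonZero = m^n≢0 2 (suc m)

  2∣M : 2 ∣ M
  2∣M = m∣m*n (2 ^ m)

  N∣L*even : ∀ {y} → 2 ∣ y → N ∣ L * y
  N∣L*even (divides q refl) =
    divides q (solve 3 (λ r p q → r :* p :* (q :* con 2) := q :* (r :* (con 2 :* p))) refl ρ (2 ^ m) q)

  face-odd : ∀ {S a} → IsFace N L S → a ∈ S → 2 ∤ toℕ a
  face-odd {a = a} face a∈S 2∣a =
    ¬IsFace-pair L 0 a∈S a∈S (+-identityʳ L) (subst (N ∣_) (sym (+-identityʳ (L * toℕ a))) (N∣L*even 2∣a)) face

  -- Writing y − x = 2^j e with e odd, j ≤ m, the weight v = ρ 2^(m−j) makes v (y − x) = L e,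
  -- so the weighted sum is L (x + e) with x + e even.
  balancingWeight : ∀ {x y} → 2 ∤ x → x ≤ y → M ∤ y ∸ x → ∃ λ v → v ≤ L × N ∣ (L ∸ v) * x + v * y
  balancingWeight {x} {y} x-odd x≤y M∤D with 2^[1+k]∤⇒2^j*odd m (y ∸ x) M∤D
  ... | j , e , j≤m , e-odd , D≡ = v , v≤L , subst (N ∣_) (sym weighted≡) (N∣L*even (odd+odd⇒even x-odd e-odd))
    where
    v : ℕ
    v = ρ * 2 ^ (m ∸ j)
    v≤L : v ≤ L
    v≤L = *-monoʳ-≤ ρ (^-monoʳ-≤ 2 (m∸n≤m m j))
    vD≡Le : v * (y ∸ x) ≡ L * e
    vD≡Le = begin
      ρ * 2 ^ (m ∸ j) * (y ∸ x)        ≡⟨ cong (ρ * 2 ^ (m ∸ j) *_) D≡ ⟩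
      ρ * 2 ^ (m ∸ j) * (2 ^ j * e)    ≡⟨ solve 4 (λ r a b e → r :* a :* (b :* e) := r :* (a :* b) :* e) refl ρ (2 ^ (m ∸ j)) (2 ^ j) e ⟩
      ρ * (2 ^ (m ∸ j) * 2 ^ j) * e    ≡⟨ cong (λ t → ρ * t * e) (sym (^-distribˡ-+-* 2 (m ∸ j) j)) ⟩
      ρ * 2 ^ (m ∸ j + j) * e          ≡⟨ cong (λ t → ρ * 2 ^ t * e) (m∸n+n≡m j≤m) ⟩
      L * e                            ∎
      where open ≡-Reasoning
    weighted≡ : (L ∸ v) * x + v * y ≡ L * (x + e)
    weighted≡ = begin
      (L ∸ v) * x + v * y              ≡⟨ cong (λ t → (L ∸ v) * x + v * t) (sym (m+[n∸m]≡n x≤y)) ⟩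
      (L ∸ v) * x + v * (x + (y ∸ x))  ≡⟨ solve 4 (λ u v x d → u :* x :+ v :* (x :+ d) := (u :+ v) :* x :+ v :* d) refl (L ∸ v) v x (y ∸ x) ⟩
      (L ∸ v + v) * x + v * (y ∸ x)    ≡⟨ cong₂ (λ a b → a * x + b) (m∸n+n≡m v≤L) vD≡Le ⟩
      L * x + L * e                    ≡⟨ sym (*-distribˡ-+ L x e) ⟩
      L * (x + e)                      ∎
      where open ≡-Reasoning

  face-sameResidue-≤ : ∀ {S a b} → IsFace N L S → a ∈ S → b ∈ S → toℕ a ≤ toℕ b → toℕ a % M ≡ toℕ b % M
  face-sameResidue-≤ face a∈S b∈S a≤b = decidable-stable (_ ≟ _) λ differ →
    let v , v≤L , N∣ = balancingWeight (face-odd face a∈S) a≤b (%≢⇒∤∸ a≤b differ)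
    in  ¬IsFace-pair (L ∸ v) v a∈S b∈S (m∸n+n≡m v≤L) N∣ face

  face-sameResidue : ∀ {S a b} → IsFace N L S → a ∈ S → b ∈ S → toℕ a % M ≡ toℕ b % M
  face-sameResidue {a = a} {b} face a∈S b∈S with ≤-total (toℕ a) (toℕ b)
  ... | inj₁ a≤b = face-sameResidue-≤ face a∈S b∈S a≤b
  ... | inj₂ b≤a = sym (face-sameResidue-≤ face b∈S a∈S b≤a)

  residueClass-isFace : ∀ {r} → 2 ∤ r → IsFace N L (residueClass N M r)
  residueClass-isFace {r} r-odd (c , support , total , N∣weighted) = odd*odd⇒odd r-odd ρ-odd 2∣rρ
    where
    ∑c≡L : ∑ c ≡ L
    ∑c≡L = trans (sym (sum-tabulate c)) total
    M∣rL : M ∣ r * L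
    M∣rL = subst (λ t → M ∣ r * t) ∑c≡L (∣m+n∣m⇒∣n
      (subst (M ∣_) (trans (sum-tabulate (λ i → c i * toℕ i)) (∑-*-toℕ-residueClass r c support))
                    (∣-trans (n∣m*n ρ) N∣weighted))
      (m∣m*n (∑ (λ i → c i * (toℕ i / M)))))
    2∣rρ : 2 ∣ r * ρ
    2∣rρ = *-cancelˡ-∣ (2 ^ m) (subst₂ _∣_ (*-comm 2 (2 ^ m))
             (solve 3 (λ r a p → r :* (a :* p) := p :* (r :* a)) refl r ρ (2 ^ m)) M∣rL)

  1<M : 1 < M
  1<M = *-monoʳ-≤ 2 (m^n>0 2 m)

  facet⊆oddClass-card : ∀ {S r} → IsFacet N L S → r < M → 2 ∤ r → S ⊆ residueClass N M r → ∣ S ∣ ≡ ρ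
  facet⊆oddClass-card {S} (_ , maximal) r<M r-odd S⊆C = begin
    ∣ S ∣                   ≡⟨ cong ∣_∣ (⊆-antisym S⊆C (maximal _ S⊆C (residueClass-isFace r-odd))) ⟩
    ∣ residueClass N M _ ∣  ≡⟨ ∣residueClass∣ ρ r<M ⟩
    ρ                       ∎
    where open ≡-Reasoning

  facet-card : ∀ {S} → IsFacet N L S → ∣ S ∣ ≡ ρ
  facet-card {S} facet@(face , _) with nonempty? S
  ... | yes (a , a∈S) = facet⊆oddClass-card facet (m%n<n (toℕ a) M) a%M-odd
                          (λ b∈S → ∈residueClass⁺ (face-sameResidue face b∈S a∈S))
    where
    a%M-odd : 2 ∤ toℕ a % M
    a%M-odd 2∣a%M = face-odd face a∈S (∣n∣m%n⇒∣m 2∣M 2∣a%M)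
  ... | no S-empty = facet⊆oddClass-card facet 1<M (>⇒∤ (s≤s (s≤s z≤n))) (λ b∈S → ⊥-elim (S-empty (_ , b∈S)))

  isPure : IsPure N L
  isPure S T S-facet T-facet = trans (facet-card S-facet) (sym (facet-card T-facet))

corollary4p1 : (ρ m : ℕ) → ρ ≥ 1 → ¬ (2 ∣ ρ) → m ≥ 1
    → IsPure (ρ * 2 ^ suc m) (ρ * 2 ^ m)
-- ρ ≥ 1 follows from oddness, and the argument does not need m ≥ 1.
corollary4p1 ρ m _ ρ-odd _ = isPure ρ m ρ-odd
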